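{- Let $T$ be a tournament, $S\subseteq V(T)$ and $k\ge 1$ an integer such that every vertex of $S$ lies on some directed triangle of $T$ and no arc of $T$ lies in $k+1$ or more $S$-triangles. If there exists $F\subseteq A(T)$ with $|F|\le k$ such that $T\circledast F$ has no $S$-cycle, then $|S| < (k+1)^2$.
   Context: A tournament is a directed graph with exactly one arc between every pair of distinct vertices. An $S$-cycle is a directed cycle containing at least one vertex of $S$; an $S$-triangle is an $S$-cycle of length three. $T\circledast F$ is the digraph obtained from $T$ by reversing every arc of $F$. -}

module Defs where

open import Data.Nat using (ℕ; _≤_; _<_; _*_; suc)
open import Data.Bool using (Bool; true; false; _∧_; _∨_)
open import Data.Fin using (Fin)
open import Data.Fin.Subset using (Subset; _∈_; ∣_∣)
open import Data.Vec using (lookup)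
open import Data.List using (List; []; _∷_; _++_; [_]; length; filterᵇ; allFin)
open import Data.List.Relation.Unary.Unique.Propositional using (Unique)
open import Data.List.Relation.Unary.All using (All)
open import Data.Product using (_×_; _,_; ∃-syntax)
open import Data.Sum using (_⊎_)
open import Data.Unit using (⊤)
open import Relation.Binary.PropositionalEquality using (_≡_; _≢_)
open import Relation.Nullary using (¬_)
import Data.List.Membership.Propositional as LM

-- A digraph on vertex set Fin n, given by its (Boolean) arc relation:
-- A u v ≡ true  means there is an arc u → v.
Digraph : ℕ → Set
Digraph n = Fin n → Fin n → Bool

IsTournament : {n : ℕ} → Digraph n → Set
IsTournament {n} A =
  ((v : Fin n) → A v v ≡ false) ×
  ((u v : Fin n) → u ≢ v → (A u v ≡ true × A v u ≡ false) ⊎ (A u v ≡ false × A v u ≡ true))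

OnTriangle : {n : ℕ} → Digraph n → Fin n → Set
OnTriangle A v = ∃[ a ] ∃[ b ] (A v a ≡ true × A a b ≡ true × A b v ≡ true)

inB : {n : ℕ} → Subset n → Fin n → Bool
inB S v = lookup S v

-- Number of S-triangles of A containing the arc u → v
-- (such a triangle is u → v → w → u, determined by w, with one of u,v,w in S).
sTriangleCount : {n : ℕ} → Digraph n → Subset n → Fin n → Fin n → ℕ
sTriangleCount {n} A S u v =
  length (filterᵇ (λ w → A v w ∧ A w u ∧ (inB S u ∨ inB S v ∨ inB S w)) (allFin n))

ArcSet : ℕ → Set
ArcSet n = List (Fin n × Fin n)

-- Arc relation of T ⊛ F (T with every arc of F reversed), as a relation.
Reverse : {n : ℕ} → Digraph n → ArcSet n → Fin n → Fin n → Set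
Reverse A F u v =
  (A u v ≡ true × ¬ ((u , v) LM.∈ F)) ⊎ (A v u ≡ true × (v , u) LM.∈ F)

Consec : {V : Set} → (V → V → Set) → List V → Set
Consec R [] = ⊤
Consec R (x ∷ []) = ⊤
Consec R (x ∷ y ∷ xs) = R x y × Consec R (y ∷ xs)

IsCycle : {V : Set} → (V → V → Set) → List V → Set
IsCycle R [] = Data.Empty.⊥
  where import Data.Empty
IsCycle R (x ∷ xs) = Unique (x ∷ xs) × 1 ≤ length xs × Consec R (x ∷ xs ++ [ x ])

HasSCycle : {n : ℕ} → (Fin n → Fin n → Set) → Subset n → Set
HasSCycle R S = ∃[ c ] (IsCycle R c × ∃[ v ] (v LM.∈ c × v ∈ S))

{-# OPTIONS --safe #-}
module Submission where

-- Each vertex v ∈ S lies on a triangle of T, which is an S-triangle; it cannot survive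
-- as a cycle of T ⊛ F, so one of its arcs e is in F.  Then v is an end of e or the third
-- vertex of an S-triangle through e.  An arc lies in at most k S-triangles, so each arc
-- of F accounts for at most k + 2 vertices of S, whence |S| ≤ |F|(k + 2) ≤ k(k + 2) < (k + 1)².

open import Defs
open import Data.Nat using (ℕ; _≤_; _<_; _*_; _+_; suc; z≤n; s≤s)
open import Data.Nat.Properties using (≤-trans; m≤n⇒m≤1+n; +-mono-≤; *-monoˡ-≤; ≤-reflexive; module ≤-Reasoning)
open import Data.Nat.Tactic.RingSolver using (solve-∀)
open import Data.Bool using (true; false; _∧_; _∨_; T)
open import Data.Bool.Properties using (∨-zeroʳ)
open import Data.Fin using (Fin; zero; suc) renaming (_≟_ to _≟ᶠ_)
open import Data.Fin.Subset using (Subset; _∈_; ∣_∣; inside; outside)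
open import Data.Vec using (_∷_; [])
import Data.Vec as Vec
open import Data.Vec.Properties using ([]=⇒lookup)
open import Data.List using (List; []; _∷_; length; allFin; filterᵇ; concatMap)
open import Data.List.Properties using (length-++)
open import Data.List.Relation.Unary.Unique.Propositional using (Unique)
open import Data.List.Relation.Unary.All using (All; []; _∷_)
import Data.List.Relation.Unary.All as All
open import Data.List.Relation.Unary.AllPairs using ([]; _∷_)
open import Data.List.Relation.Unary.Any using (here; there)
import Data.List.Membership.Propositional as List
open import Data.List.Membership.Propositional using (lose)
open import Data.List.Membership.Propositional.Properties using (∈-filter⁺; ∈-allFin; ∈-concatMap⁺)
open import Data.Product using (_,_; proj₁; proj₂; uncurry)
open import Data.Product.Properties using (≡-dec)
open import Data.Sum using (_⊎_; inj₁; inj₂)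
open import Data.Unit using (tt)
open import Relation.Binary.PropositionalEquality using (_≡_; _≢_; refl; sym; trans; subst)
open import Relation.Nullary using (¬_; yes; no; contradiction)
import Data.List.Membership.DecPropositional as DecMembership

private
  variable
    n : ℕ

dropZero : List (Fin (suc n)) → List (Fin n)
dropZero []           = []
dropZero (zero  ∷ xs) = dropZero xs
dropZero (suc x ∷ xs) = x ∷ dropZero xs

length-dropZero-≤ : (xs : List (Fin (suc n))) → length (dropZero xs) ≤ length xs
length-dropZero-≤ []           = z≤n
length-dropZero-≤ (zero  ∷ xs) = m≤n⇒m≤1+n (length-dropZero-≤ xs)
length-dropZero-≤ (suc x ∷ xs) = s≤s (length-dropZero-≤ xs)

length-dropZero-< : (xs : List (Fin (suc n))) → zero List.∈ xs → length (dropZero xs) < length xs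
length-dropZero-< (zero  ∷ xs) _         = s≤s (length-dropZero-≤ xs)
length-dropZero-< (suc x ∷ xs) (there p) = s≤s (length-dropZero-< xs p)

∈-dropZero⁺ : (xs : List (Fin (suc n))) {v : Fin n} → suc v List.∈ xs → v List.∈ dropZero xs
∈-dropZero⁺ (zero  ∷ xs) (there p)   = ∈-dropZero⁺ xs p
∈-dropZero⁺ (suc x ∷ xs) (here refl) = here refl
∈-dropZero⁺ (suc x ∷ xs) (there p)   = there (∈-dropZero⁺ xs p)

∣p∣≤length : (p : Subset n) (xs : List (Fin n)) → (∀ v → v ∈ p → v List.∈ xs) → ∣ p ∣ ≤ length xs
∣p∣≤length []            xs p⊆xs = z≤n
∣p∣≤length (outside ∷ p) xs p⊆xs =
  ≤-trans (∣p∣≤length p (dropZero xs) (λ v v∈p → ∈-dropZero⁺ xs (p⊆xs (suc v) (Vec.there v∈p))))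
          (length-dropZero-≤ xs)
∣p∣≤length (inside ∷ p)  xs p⊆xs =
  ≤-trans (s≤s (∣p∣≤length p (dropZero xs) (λ v v∈p → ∈-dropZero⁺ xs (p⊆xs (suc v) (Vec.there v∈p)))))
          (length-dropZero-< xs (p⊆xs zero Vec.here))

length-concatMap-≤ : {A B : Set} (f : A → List B) {c : ℕ} {xs : List A} →
  All (λ x → length (f x) ≤ c) xs → length (concatMap f xs) ≤ length xs * c
length-concatMap-≤ f []                       = z≤n
length-concatMap-≤ f {xs = x ∷ xs} (fx≤c ∷ bounds) =
  subst (_≤ length (x ∷ xs) * _) (sym (length-++ (f x)))
        (+-mono-≤ fx≤c (length-concatMap-≤ f bounds))

triangle-isCycle : {V : Set} {R : V → V → Set} {x y z : V} →
  x ≢ y → y ≢ z → z ≢ x → R x y → R y z → R z x → IsCycle R (x ∷ y ∷ z ∷ [])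
triangle-isCycle x≢y y≢z z≢x Rxy Ryz Rzx =
  ((x≢y ∷ (λ x≡z → z≢x (sym x≡z)) ∷ []) ∷ (y≢z ∷ []) ∷ [] ∷ []) ,
  s≤s z≤n ,
  Rxy , Ryz , Rzx , tt

k*[2+k]<[k+1]*[k+1] : (k : ℕ) → k * (2 + k) < (k + 1) * (k + 1)
k*[2+k]<[k+1]*[k+1] k = ≤-reflexive (suc-k*[2+k] k)
  where
  suc-k*[2+k] : (k : ℕ) → suc (k * (2 + k)) ≡ (k + 1) * (k + 1)
  suc-k*[2+k] = solve-∀

module _ (A : Digraph n) (S : Subset n) where

  -- The filter is literally the one in sTriangleCount, so this list has length
  -- 2 + sTriangleCount A S u v by definition.
  sTriangleVertices : Fin n → Fin n → List (Fin n)
  sTriangleVertices u v = u ∷ v ∷ filterᵇ (λ w → A v w ∧ A w u ∧ (inB S u ∨ inB S v ∨ inB S w)) (allFin n)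

  apex-∈-sTriangleVertices : ∀ {u v w} → A v w ≡ true → A w u ≡ true → w ∈ S →
    w List.∈ sTriangleVertices u v
  apex-∈-sTriangleVertices {u} {v} {w} Avw Awu w∈S =
    there (there (∈-filter⁺ _ (∈-allFin w) apex-condition))
    where
    apex-condition : T (A v w ∧ A w u ∧ (inB S u ∨ inB S v ∨ inB S w))
    apex-condition rewrite Avw | Awu | []=⇒lookup w∈S | ∨-zeroʳ (inB S v) | ∨-zeroʳ (inB S u) = tt

  module _ (loopless : (v : Fin n) → A v v ≡ false) (F : ArcSet n)
           (noSCycle : ¬ HasSCycle (Reverse A F) S) where

    open DecMembership (≡-dec (_≟ᶠ_ {n}) (_≟ᶠ_ {n})) using (_∈?_)

    arc⇒≢ : ∀ {x y} → A x y ≡ true → x ≢ y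
    arc⇒≢ {x} Axy refl = contradiction (trans (sym (loopless x)) Axy) λ ()

    sTriangle-meets-F : ∀ {v a b} → v ∈ S → A v a ≡ true → A a b ≡ true → A b v ≡ true →
      (v , a) List.∈ F ⊎ (a , b) List.∈ F ⊎ (b , v) List.∈ F
    sTriangle-meets-F {v} {a} {b} v∈S Ava Aab Abv with (v , a) ∈? F | (a , b) ∈? F | (b , v) ∈? F
    ... | yes va∈F | _        | _        = inj₁ va∈F
    ... | no _     | yes ab∈F | _        = inj₂ (inj₁ ab∈F)
    ... | no _     | no _     | yes bv∈F = inj₂ (inj₂ bv∈F)
    ... | no va∉F  | no ab∉F  | no bv∉F  = contradiction
      (v ∷ a ∷ b ∷ [] ,
       triangle-isCycle (arc⇒≢ Ava) (arc⇒≢ Aab) (arc⇒≢ Abv)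
                        (inj₁ (Ava , va∉F)) (inj₁ (Aab , ab∉F)) (inj₁ (Abv , bv∉F)) ,
       v , here refl , v∈S)
      noSCycle

    S⊆sTriangleVertices-F : ∀ v → v ∈ S → OnTriangle A v →
      v List.∈ concatMap (uncurry sTriangleVertices) F
    S⊆sTriangleVertices-F v v∈S (a , b , Ava , Aab , Abv) with sTriangle-meets-F v∈S Ava Aab Abv
    ... | inj₁ va∈F        = ∈-concatMap⁺ _ (lose va∈F (here refl))
    ... | inj₂ (inj₁ ab∈F) = ∈-concatMap⁺ _ (lose ab∈F (apex-∈-sTriangleVertices Abv Ava v∈S))
    ... | inj₂ (inj₂ bv∈F) = ∈-concatMap⁺ _ (lose bv∈F (there (here refl)))

mainTheorem11 : (n : ℕ) (A : Digraph n) (S : Subset n) (k : ℕ) →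
    IsTournament A → 1 ≤ k →
    ((v : Fin n) → v ∈ S → OnTriangle A v) →
    ((u v : Fin n) → A u v ≡ true → sTriangleCount A S u v ≤ k) →
    (F : ArcSet n) → Unique F → All (λ e → A (proj₁ e) (proj₂ e) ≡ true) F →
    length F ≤ k → ¬ HasSCycle (Reverse A F) S →
    ∣ S ∣ < (k + 1) * (k + 1)
mainTheorem11 n A S k (loopless , _) _ onTriangle count≤k F _ F⊆A |F|≤k noSCycle = begin-strict
  ∣ S ∣               ≤⟨ ∣p∣≤length S _ S⊆cover ⟩
  length cover        ≤⟨ length-concatMap-≤ _ (All.map sTriangleVertices≤2+k F⊆A) ⟩
  length F * (2 + k)  ≤⟨ *-monoˡ-≤ (2 + k) |F|≤k ⟩
  k * (2 + k)         <⟨ k*[2+k]<[k+1]*[k+1] k ⟩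
  (k + 1) * (k + 1)   ∎
  where
  open ≤-Reasoning
  cover : List (Fin n)
  cover = concatMap (uncurry (sTriangleVertices A S)) F

  S⊆cover : ∀ v → v ∈ S → v List.∈ cover
  S⊆cover v v∈S = S⊆sTriangleVertices-F A S loopless F noSCycle v v∈S (onTriangle v v∈S)

  sTriangleVertices≤2+k : ∀ {u v} → A u v ≡ true → length (sTriangleVertices A S u v) ≤ 2 + k
  sTriangleVertices≤2+k Auv = s≤s (s≤s (count≤k _ _ Auv))
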